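{- There is an algorithm which, given a finite lattice $L$, decides whether or not $L$ is isomorphic to the lattice of flats $\mathrm{Fl}\,\mathcal{H}$ of some boolean representable simplicial complex $\mathcal{H}$.
   Context: A (finite) simplicial complex is a pair $\mathcal{H}=(V,H)$ with $V$ finite nonempty and $H\subseteq 2^V$ nonempty and closed under subsets. A subset $X\subseteq V$ is a flat if for every $I\in H$ with $I\subseteq X$ and every $p\in V\setminus X$ we have $I\cup\{p\}\in H$; flats ordered by inclusion form the lattice $\mathrm{Fl}\,\mathcal{H}$. A set $X$ is a transversal of the successive differences for a chain of subsets $A_0\subset\cdots\subset A_k$ if $X$ has an enumeration $x_1,\dots,x_k$ with $x_i\in A_i\setminus A_{i-1}$; $\mathcal{H}$ is boolean representable if every $X\in H$ is such a transversal for some chain in $\mathrm{Fl}\,\mathcal{H}$. -}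

module Defs where

open import Level using (0ℓ)
open import Data.Nat using (ℕ; suc)
open import Data.Bool using (Bool; true)
open import Data.Fin using (Fin; inject₁) renaming (suc to fsuc)
open import Data.Fin.Subset using (Subset; _∈_; _∉_; _⊆_; _⊂_; _∪_; ⁅_⁆; ∣_∣)
open import Data.Product using (Σ; ∃; _×_; _,_)
open import Function using (_⇔_)
open import Function.Definitions using (Injective)
open import Relation.Binary using (Rel; Decidable)
open import Relation.Binary.PropositionalEquality using (_≡_)
open import Relation.Binary.Lattice.Structures using (IsLattice)

record FinLattice : Set₁ where
  field
    size      : ℕ
    _≤_       : Rel (Fin size) 0ℓ
    _≤?_      : Decidable _≤_
    _∨_       : Fin size → Fin size → Fin size
    _∧_       : Fin size → Fin size → Fin size
    isLattice : IsLattice _≡_ _≤_ _∨_ _∧_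

record SimplicialComplex : Set where
  field
    k          : ℕ
    H          : Subset (suc k) → Bool
    nonempty   : ∃ λ I → H I ≡ true
    downClosed : ∀ I J → J ⊆ I → H I ≡ true → H J ≡ true

module _ (𝓗 : SimplicialComplex) where
  open SimplicialComplex 𝓗

  V : Set
  V = Fin (suc k)

  IsFlat : Subset (suc k) → Set
  IsFlat X = ∀ I → H I ≡ true → I ⊆ X → ∀ p → p ∉ X → H (I ∪ ⁅ p ⁆) ≡ true

  IsFlatChainTransversal : Subset (suc k) → Set
  IsFlatChainTransversal X =
    Σ ℕ λ r → Σ (Fin (suc r) → Subset (suc k)) λ A → Σ (Fin r → V) λ x →
      (∀ i → IsFlat (A i))
      × (∀ (i : Fin r) → A (inject₁ i) ⊂ A (fsuc i))
      × Injective _≡_ _≡_ x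
      × (∀ v → (v ∈ X) ⇔ (∃ λ i → x i ≡ v))
      × (∀ (i : Fin r) → (x i ∈ A (fsuc i)) × (x i ∉ A (inject₁ i)))

  BooleanRepresentable : Set
  BooleanRepresentable = ∀ X → H X ≡ true → IsFlatChainTransversal X

  IsoToFlats : FinLattice → Set
  IsoToFlats L =
    Σ (Fin size → Subset (suc k)) λ f →
      (∀ a → IsFlat (f a))
      × (∀ a b → (a ≤ b) ⇔ (f a ⊆ f b))
      × (∀ X → IsFlat X → ∃ λ a → f a ≡ X)
    where open FinLattice L

IsBRFlatLattice : FinLattice → Set
IsBRFlatLattice L =
  Σ SimplicialComplex λ 𝓗 → BooleanRepresentable 𝓗 × IsoToFlats 𝓗 L

-- Fix A ⊆ L and call X ⊆ A independent when every nonempty Y ⊆ X has an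
-- element y ≰ ⋁ (Y - y). The independent sets form a boolean representable
-- complex on the vertex set L: removing such elements one at a time lists X as
-- a transversal of the chain of flats ↓ (⋁ X′), X′ running over the successive
-- remainders, where ↓ a = {v | v ∈ A → v ≤ a}. Conversely, if L ≅ Fl 𝓗 with 𝓗 boolean
-- representable, let cl p be the least element of L whose flat contains the
-- vertex p and take A = {cl p}. In a face of 𝓗 the element coming last in the
-- chain is outside the flat spanned by the others, so cl maps faces injectively
-- onto independent sets; by induction the converse holds too, which makes
-- a ↦ ↓ a an isomorphism L ≅ Fl (complex A). Thus L is a boolean representable
-- flat lattice iff some A ⊆ L makes ↓ an isomorphism, and that is a finite check.

module Submission where

open import Defs
open import Relation.Nullary using (Dec)

open import Level using (0ℓ)
open import Algebra.Core using (Op₂)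
open import Data.Nat as ℕ using (ℕ; zero; suc)
open import Data.Bool using (true; false)
import Data.Bool.Properties as Bool
open import Data.Fin as Fin using (Fin; zero; suc; inject₁; fromℕ; toℕ; _≟_)
open import Data.Fin.Properties using (any?; all?; ¬Fin0; 0≢1+n; suc-injective; toℕ-inject₁; ≤∧≢⇒<)
open import Data.Fin.Subset
  using (Subset; _∈_; _∉_; _⊆_; _⊂_; _∪_; _∩_; _─_; _-_; ⁅_⁆; Nonempty; ⊤) renaming (⊥ to ∅)
open import Data.Fin.Subset.Properties
  using ( _∈?_; _⊆?_; anySubset?; nonempty?; ∈⊤; ⊥⊆; ∉⊥; x∈⁅x⁆; x∈⁅y⁆⇒x≡y; p─q⊆p
        ; x∈p∧x≢y⇒x∈p-y; x∈p⇒p-x⊂p; x∈p∪q⁺; x∈p∪q⁻; x∈p∩q⁺; x∈p∩q⁻; ⊆-antisym )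
open import Data.Fin.Subset.Induction using (⊂-wellFounded)
open import Data.List using (foldr; filter; allFin)
open import Data.List.Properties using (foldr-preservesᵇ; foldr-preservesᵒ)
import Data.List.Relation.Unary.All as All
open import Data.List.Relation.Unary.All.Properties using (all-filter)
import Data.List.Relation.Unary.Any as Any
open import Data.List.Membership.Propositional using () renaming (_∈_ to _∈ₗ_)
open import Data.List.Membership.Propositional.Properties using (∈-allFin; ∈-filter⁺)
open import Data.Vec using (_∷_; here; there; tabulate)
open import Data.Vec.Properties using (lookup⇒[]=; []=⇒lookup; lookup∘tabulate; ≡-dec)
open import Data.Product using (∃; _×_; _,_; proj₁; proj₂)
open import Data.Sum using (inj₁; inj₂; [_,_])
open import Data.Empty using (⊥-elim)
open import Function using (_⇔_; mk⇔; _∘_; id)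
open import Function.Bundles using (Equivalence)
open import Function.Definitions using (Injective)
open import Induction.WellFounded using (Acc; acc)
open import Relation.Binary using (Rel; Decidable)
open import Relation.Binary.Lattice.Structures using (IsLattice)
open import Relation.Binary.PropositionalEquality using (_≡_; _≢_; refl; sym; trans; cong; subst)
open import Relation.Nullary using (yes; no; ¬_; does)
open import Relation.Nullary.Decidable
  using (map′; _×-dec_; _→-dec_; ¬?; dec-true; decidable-stable)

private
  variable
    n r : ℕ

dec-true⁻¹ : ∀ {A : Set} (a? : Dec A) → does a? ≡ true → A
dec-true⁻¹ (yes a) _ = a

_⇔-dec_ : ∀ {A B : Set} → Dec A → Dec B → Dec (A ⇔ B)
a? ⇔-dec b? = map′ (λ (to , from) → mk⇔ to from) (λ e → Equivalence.to e , Equivalence.from e)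
                   ((a? →-dec b?) ×-dec (b? →-dec a?))

allSubset? : {P : Subset n → Set} → (∀ X → Dec (P X)) → Dec (∀ X → P X)
allSubset? P? = map′ (λ noCounterexample X → decidable-stable (P? X) (λ ¬PX → noCounterexample (X , ¬PX)))
                     (λ ∀P (X , ¬PX) → ¬PX (∀P X))
                     (¬? (anySubset? (¬? ∘ P?)))

module _ {P : Fin n → Set} (P? : ∀ x → Dec (P x)) where

  subsetOf : Subset n
  subsetOf = tabulate (does ∘ P?)

  ∈-subsetOf⁺ : ∀ {x} → P x → x ∈ subsetOf
  ∈-subsetOf⁺ {x} px = lookup⇒[]= x subsetOf (trans (lookup∘tabulate (does ∘ P?) x) (dec-true (P? x) px))

  ∈-subsetOf⁻ : ∀ {x} → x ∈ subsetOf → P x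
  ∈-subsetOf⁻ {x} x∈ = dec-true⁻¹ (P? x) (trans (sym (lookup∘tabulate (does ∘ P?) x)) ([]=⇒lookup x∈))

module _ {m} (g : Fin m → Fin n) where

  hasPreimage? : (W : Subset m) → ∀ b → Dec (∃ λ a → a ∈ W × g a ≡ b)
  hasPreimage? W b = any? (λ a → (a ∈? W) ×-dec (g a ≟ b))

  image : Subset m → Subset n
  image W = subsetOf (hasPreimage? W)

  ∈-image⁺ : ∀ {W a} → a ∈ W → g a ∈ image W
  ∈-image⁺ {W} a∈W = ∈-subsetOf⁺ (hasPreimage? W) (_ , a∈W , refl)

  ∈-image⁻ : ∀ {W b} → b ∈ image W → ∃ λ a → a ∈ W × g a ≡ b
  ∈-image⁻ {W} = ∈-subsetOf⁻ (hasPreimage? W)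

  image-mono : ∀ {W W′} → W ⊆ W′ → image W ⊆ image W′
  image-mono W⊆W′ b∈ with ∈-image⁻ b∈
  ... | _ , a∈W , refl = ∈-image⁺ (W⊆W′ a∈W)

x∈p─q⇒x∉q : ∀ {p q : Subset n} {x} → x ∈ p ─ q → x ∉ q
x∈p─q⇒x∉q {p = true ∷ _}  {q = false ∷ _} here ()
x∈p─q⇒x∉q {p = _ ∷ _}     {q = _ ∷ _}     (there x∈) (there x∈q) = x∈p─q⇒x∉q x∈ x∈q

x∈p-y⇒x≢y : ∀ {p : Subset n} {x y} → x ∈ p - y → x ≢ y
x∈p-y⇒x≢y x∈ refl = x∈p─q⇒x∉q x∈ (x∈⁅x⁆ _)

p⊆q∪⁅x⁆⇒p-x⊆q : ∀ {p q : Subset n} {x} → p ⊆ q ∪ ⁅ x ⁆ → p - x ⊆ q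
p⊆q∪⁅x⁆⇒p-x⊆q {q = q} {x} p⊆ {y} y∈ with x∈p∪q⁻ q ⁅ x ⁆ (p⊆ (p─q⊆p _ _ y∈))
... | inj₁ y∈q  = y∈q
... | inj₂ y∈⁅x⁆ = ⊥-elim (x∈p-y⇒x≢y y∈ (x∈⁅y⁆⇒x≡y x y∈⁅x⁆))

p⊆p-x∪⁅x⁆ : ∀ {p : Subset n} {x} → p ⊆ (p - x) ∪ ⁅ x ⁆
p⊆p-x∪⁅x⁆ {x = x} {y} y∈p with y ≟ x
... | yes refl = x∈p∪q⁺ (inj₂ (x∈⁅x⁆ x))
... | no  y≢x  = x∈p∪q⁺ (inj₁ (x∈p∧x≢y⇒x∈p-y y∈p y≢x))

∃-max : ∀ {P : Fin n → Set} → (∀ i → Dec (P i)) → ∃ P → ∃ λ i → P i × (∀ j → P j → j Fin.≤ i)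
∃-max {zero} P? (() , _)
∃-max {suc n} P? (i , Pi) with any? (P? ∘ suc)
... | yes Psuc with ∃-max (P? ∘ suc) Psuc
...   | j , Pj , maximal = suc j , Pj , λ { zero _ → ℕ.z≤n ; (suc k) Pk → ℕ.s≤s (maximal k Pk) }
∃-max {suc n} P? (zero  , P0) | no ¬Psuc =
  zero , P0 , λ { zero _ → ℕ.z≤n ; (suc k) Pk → ⊥-elim (¬Psuc (k , Pk)) }
∃-max {suc n} P? (suc i , Pi) | no ¬Psuc = ⊥-elim (¬Psuc (i , Pi))

module _ {S : Set} where

  snoc : (Fin r → S) → S → Fin (suc r) → S
  snoc {zero}  f s zero    = s
  snoc {suc r} f s zero    = f zero
  snoc {suc r} f s (suc i) = snoc (f ∘ suc) s i

  snoc-inject₁ : (f : Fin r → S) (s : S) (i : Fin r) → snoc f s (inject₁ i) ≡ f i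
  snoc-inject₁ {suc r} f s zero    = refl
  snoc-inject₁ {suc r} f s (suc i) = snoc-inject₁ (f ∘ suc) s i

  snoc-fromℕ : (f : Fin r → S) (s : S) → snoc f s (fromℕ r) ≡ s
  snoc-fromℕ {zero}  f s = refl
  snoc-fromℕ {suc r} f s = snoc-fromℕ (f ∘ suc) s

  snoc-∀ : {P : S → Set} {f : Fin r → S} {s : S} → (∀ i → P (f i)) → P s → ∀ i → P (snoc f s i)
  snoc-∀ {zero}  Pf Ps zero    = Ps
  snoc-∀ {suc r} Pf Ps zero    = Pf zero
  snoc-∀ {suc r} {P} Pf Ps (suc i) = snoc-∀ {P = P} (Pf ∘ suc) Ps i

  snoc-injective : {f : Fin r → S} {s : S} → Injective _≡_ _≡_ f → (∀ i → f i ≢ s) →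
                   Injective _≡_ _≡_ (snoc f s)
  snoc-injective {zero}  _     _   {zero}  {zero}  _  = refl
  snoc-injective {suc r} _     _   {zero}  {zero}  _  = refl
  snoc-injective {suc r} {f} f-inj f≢s {zero}  {suc j} eq =
    ⊥-elim (snoc-∀ {P = f zero ≢_} (λ i eq′ → 0≢1+n (f-inj eq′)) (f≢s zero) j eq)
  snoc-injective {suc r} {f} f-inj f≢s {suc i} {zero}  eq =
    ⊥-elim (snoc-∀ {P = f zero ≢_} (λ j eq′ → 0≢1+n (f-inj eq′)) (f≢s zero) i (sym eq))
  snoc-injective {suc r} f-inj f≢s {suc i} {suc j} eq =
    cong suc (snoc-injective (suc-injective ∘ f-inj) (f≢s ∘ suc) eq)

snoc-adjacent : ∀ {S T : Set} (R : S → S → T → Set) {f : Fin (suc r) → S} {s : S} {x : Fin r → T} {t : T} →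
                (∀ i → R (f (inject₁ i)) (f (suc i)) (x i)) → R (f (fromℕ r)) s t →
                ∀ i → R (snoc f s (inject₁ i)) (snoc f s (suc i)) (snoc x t i)
snoc-adjacent {zero}  R Rf Rlast zero    = Rlast
snoc-adjacent {suc r} R Rf Rlast zero    = Rf zero
snoc-adjacent {suc r} R Rf Rlast (suc i) = snoc-adjacent R (Rf ∘ suc) Rlast i

chain-mono : ∀ {C : Fin (suc r) → Subset n} → (∀ i → C (inject₁ i) ⊆ C (suc i)) →
             ∀ {i j} → i Fin.≤ j → C i ⊆ C j
chain-mono {zero}  C⊆ {zero}  {zero}  _          = id
chain-mono {suc r} C⊆ {zero}  {zero}  _          = id
chain-mono {suc r} C⊆ {zero}  {suc j} _          = chain-mono (C⊆ ∘ suc) {zero} {j} ℕ.z≤n ∘ C⊆ zero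
chain-mono {suc r} C⊆ {suc i} {suc j} (ℕ.s≤s i≤j) = chain-mono (C⊆ ∘ suc) i≤j

module _ (𝓗 : SimplicialComplex) where
  open SimplicialComplex 𝓗

  empty-face : ∀ {Z} → ¬ Nonempty Z → H Z ≡ true
  empty-face ¬Z = downClosed _ _ (λ z∈ → ⊥-elim (¬Z (_ , z∈))) (proj₂ nonempty)

  isFlat? : ∀ X → Dec (IsFlat 𝓗 X)
  isFlat? X = allSubset? λ I → (H I Bool.≟ true) →-dec ((I ⊆? X) →-dec
                all? (λ p → ¬? (p ∈? X) →-dec (H (I ∪ ⁅ p ⁆) Bool.≟ true)))

  ⊤-flat : IsFlat 𝓗 ⊤
  ⊤-flat _ _ _ p p∉⊤ = ⊥-elim (p∉⊤ ∈⊤)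

  ∩-flat : ∀ {X Y} → IsFlat 𝓗 X → IsFlat 𝓗 Y → IsFlat 𝓗 (X ∩ Y)
  ∩-flat {X} {Y} X-flat Y-flat I I-face I⊆X∩Y p p∉X∩Y with p ∈? X
  ... | no  p∉X = X-flat I I-face (proj₁ ∘ x∈p∩q⁻ X Y ∘ I⊆X∩Y) p p∉X
  ... | yes p∈X = Y-flat I I-face (proj₂ ∘ x∈p∩q⁻ X Y ∘ I⊆X∩Y) p (λ p∈Y → p∉X∩Y (x∈p∩q⁺ (p∈X , p∈Y)))

  record FlatChainTransversal (X B : Subset (suc k)) : Set where
    field
      length           : ℕ
      chain            : Fin (suc length) → Subset (suc k)
      elem             : Fin length → V 𝓗
      chain-flat       : ∀ i → IsFlat 𝓗 (chain i)
      chain-⊂          : ∀ i → chain (inject₁ i) ⊂ chain (suc i)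
      elem-injective   : Injective _≡_ _≡_ elem
      elem-enumerates  : ∀ v → (v ∈ X) ⇔ (∃ λ i → elem i ≡ v)
      elem-transversal : ∀ i → (elem i ∈ chain (suc i)) × (elem i ∉ chain (inject₁ i))
      chain-top        : chain (fromℕ length) ≡ B

  isFlatChainTransversal : ∀ {X B} → FlatChainTransversal X B → IsFlatChainTransversal 𝓗 X
  isFlatChainTransversal t =
    length , chain , elem , chain-flat , chain-⊂ , elem-injective , elem-enumerates , elem-transversal
    where open FlatChainTransversal t

  trivialTransversal : ∀ {X B} → ¬ Nonempty X → IsFlat 𝓗 B → FlatChainTransversal X B
  trivialTransversal ¬X B-flat = record
    { length           = 0
    ; chain            = λ _ → _
    ; elem             = λ ()
    ; chain-flat       = λ _ → B-flat
    ; chain-⊂          = λ ()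
    ; elem-injective   = λ { {()} }
    ; elem-enumerates  = λ v → mk⇔ (λ v∈X → ⊥-elim (¬X (v , v∈X))) (λ { (() , _) })
    ; elem-transversal = λ ()
    ; chain-top        = refl
    }

  extendTransversal : ∀ {X B B′ y} → y ∈ X → FlatChainTransversal (X - y) B →
                      IsFlat 𝓗 B′ → B ⊆ B′ → y ∈ B′ → y ∉ B → FlatChainTransversal X B′
  extendTransversal {X} {B} {B′} {y} y∈X t B′-flat B⊆B′ y∈B′ y∉B = record
    { length           = suc length
    ; chain            = snoc chain B′
    ; elem             = snoc elem y
    ; chain-flat       = snoc-∀ {P = IsFlat 𝓗} chain-flat B′-flat
    ; chain-⊂          = snoc-adjacent (λ C C′ _ → C ⊂ C′) {x = elem} {t = y} chain-⊂
                           (subst (_⊂ B′) (sym chain-top) (B⊆B′ , y , y∈B′ , y∉B))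
    ; elem-injective   = snoc-injective elem-injective (λ i → x∈p-y⇒x≢y (elem∈X-y i))
    ; elem-enumerates  = λ v → mk⇔ enumerate (λ { (i , refl) → snoc-∀ {P = _∈ X} elem∈X y∈X i })
    ; elem-transversal = snoc-adjacent (λ C C′ x → x ∈ C′ × x ∉ C) elem-transversal
                           (y∈B′ , subst (y ∉_) (sym chain-top) y∉B)
    ; chain-top        = snoc-fromℕ chain B′
    }
    where
    open FlatChainTransversal t
    elem∈X-y : ∀ i → elem i ∈ X - y
    elem∈X-y i = Equivalence.from (elem-enumerates _) (i , refl)
    elem∈X : ∀ i → elem i ∈ X
    elem∈X = p─q⊆p X ⁅ y ⁆ ∘ elem∈X-y
    enumerate : ∀ {v} → v ∈ X → ∃ λ i → snoc elem y i ≡ v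
    enumerate {v} v∈X with v ≟ y
    ... | yes refl = fromℕ length , snoc-fromℕ elem y
    ... | no  v≢y with Equivalence.to (elem-enumerates v) (x∈p∧x≢y⇒x∈p-y v∈X v≢y)
    ...   | i , refl = inject₁ i , snoc-inject₁ elem y i

  -- q is the element of W coming last in the chain, F the flat just below it.
  transversal-separates : ∀ {I W} → IsFlatChainTransversal 𝓗 I → W ⊆ I → Nonempty W →
                          ∃ λ q → q ∈ W × ∃ λ F → IsFlat 𝓗 F × W - q ⊆ F × q ∉ F
  transversal-separates {W = W} (_ , C , x , C-flat , C-⊂ , _ , enum , transv) W⊆I (w , w∈W)
    with Equivalence.to (enum w) (W⊆I w∈W)
  ... | i₀ , refl with ∃-max (λ i → x i ∈? W) (i₀ , w∈W)
  ...   | i , xᵢ∈W , maximal = x i , xᵢ∈W , C (inject₁ i) , C-flat _ , earlier , proj₂ (transv i)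
    where
    earlier : W - x i ⊆ C (inject₁ i)
    earlier {v} v∈ with Equivalence.to (enum v) (W⊆I (p─q⊆p W _ v∈))
    ... | j , refl = chain-mono {C = C} (proj₁ ∘ C-⊂) sucj≤i (proj₁ (transv j))
      where
      j<i : j Fin.< i
      j<i = ≤∧≢⇒< (maximal j (p─q⊆p W _ v∈)) (λ { refl → x∈p-y⇒x≢y v∈ refl })
      sucj≤i : suc j Fin.≤ inject₁ i
      sucj≤i = subst (suc (toℕ j) ℕ.≤_) (sym (toℕ-inject₁ i)) j<i

module LatticeFolds {C : Set} {_≤_ : Rel C 0ℓ} {_∨_ _∧_ : Op₂ C}
                    (isLattice : IsLattice _≡_ _≤_ _∨_ _∧_) where
  open IsLattice isLattice using (x≤x∨y; y≤x∨y; x∧y≤x; x∧y≤y) renaming (refl to ≤-refl; trans to ≤-trans)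

  ≤-foldr-∨ : ∀ {x} z {xs} → x ∈ₗ xs → x ≤ foldr _∨_ z xs
  ≤-foldr-∨ {x} z {xs} x∈xs = foldr-preservesᵒ {P = x ≤_}
    (λ a b → [ (λ x≤a → ≤-trans x≤a (x≤x∨y a b)) , (λ x≤b → ≤-trans x≤b (y≤x∨y a b)) ])
    z xs (inj₂ (Any.map (λ { refl → ≤-refl }) x∈xs))

  foldr-∧-≤ : ∀ {x} z {xs} → x ∈ₗ xs → foldr _∧_ z xs ≤ x
  foldr-∧-≤ {x} z {xs} x∈xs = foldr-preservesᵒ {P = _≤ x}
    (λ a b → [ ≤-trans (x∧y≤x a b) , ≤-trans (x∧y≤y a b) ])
    z xs (inj₂ (Any.map (λ { refl → ≤-refl }) x∈xs))

module FlatLatticeCriterion {m : ℕ} {_≤_ : Rel (Fin (suc m)) 0ℓ} {_∨_ _∧_ : Op₂ (Fin (suc m))}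
                            (_≤?_ : Decidable _≤_) (isLattice : IsLattice _≡_ _≤_ _∨_ _∧_) where

  L : FinLattice
  L = record { size = suc m ; _≤_ = _≤_ ; _≤?_ = _≤?_ ; _∨_ = _∨_ ; _∧_ = _∧_ ; isLattice = isLattice }

  open IsLattice isLattice using (∨-least; ∧-greatest) renaming (trans to ≤-trans)
  open LatticeFolds isLattice

  bottom : Fin (suc m)
  bottom = foldr _∧_ zero (allFin _)

  bottom-≤ : ∀ x → bottom ≤ x
  bottom-≤ x = foldr-∧-≤ zero (∈-allFin x)

  ⋁ : Subset (suc m) → Fin (suc m)
  ⋁ S = foldr _∨_ bottom (filter (_∈? S) (allFin _))

  ⋁-upper : ∀ {S i} → i ∈ S → i ≤ ⋁ S
  ⋁-upper {S} i∈S = ≤-foldr-∨ bottom (∈-filter⁺ (_∈? S) (∈-allFin _) i∈S)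

  ⋁-least : ∀ {S c} → (∀ {i} → i ∈ S → i ≤ c) → ⋁ S ≤ c
  ⋁-least {S} {c} S≤c =
    foldr-preservesᵇ {P = _≤ c} ∨-least (bottom-≤ c) (All.map S≤c (all-filter (_∈? S) (allFin _)))

  ⋁-mono : ∀ {S T} → S ⊆ T → ⋁ S ≤ ⋁ T
  ⋁-mono S⊆T = ⋁-least (λ i∈S → ⋁-upper (S⊆T i∈S))

  module IndependentSets (A : Subset (suc m)) where

    Independent : Subset (suc m) → Set
    Independent X = X ⊆ A × (∀ Y → Y ⊆ X → Nonempty Y → ∃ λ y → y ∈ Y × ¬ (y ≤ ⋁ (Y - y)))

    independent? : ∀ X → Dec (Independent X)
    independent? X = (X ⊆? A) ×-dec allSubset? (λ Y → (Y ⊆? X) →-dec (nonempty? Y →-dec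
                       any? (λ y → (y ∈? Y) ×-dec ¬? (y ≤? ⋁ (Y - y)))))

    independent-⊆ : ∀ {X W} → Independent X → W ⊆ X → Independent W
    independent-⊆ (X⊆A , free) W⊆X =
      (λ w∈W → X⊆A (W⊆X w∈W)) , λ Y Y⊆W → free Y (λ y∈Y → W⊆X (Y⊆W y∈Y))

    independent-∅ : Independent ∅
    independent-∅ = ⊥⊆ , λ Y Y⊆∅ (y , y∈Y) → ⊥-elim (∉⊥ (Y⊆∅ y∈Y))

    independent-extend : ∀ {I p} → Independent I → p ∈ A → ¬ (p ≤ ⋁ I) → Independent (I ∪ ⁅ p ⁆)
    independent-extend {I} {p} (I⊆A , free) p∈A p≰⋁I = I∪p⊆A , free′
      where
      I∪p⊆A : I ∪ ⁅ p ⁆ ⊆ A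
      I∪p⊆A v∈ with x∈p∪q⁻ I ⁅ p ⁆ v∈
      ... | inj₁ v∈I = I⊆A v∈I
      ... | inj₂ v∈p = subst (_∈ A) (sym (x∈⁅y⁆⇒x≡y p v∈p)) p∈A
      free′ : ∀ Y → Y ⊆ I ∪ ⁅ p ⁆ → Nonempty Y → ∃ λ y → y ∈ Y × ¬ (y ≤ ⋁ (Y - y))
      free′ Y Y⊆ Y≠∅ with p ∈? Y
      ... | yes p∈Y = p , p∈Y , λ p≤ → p≰⋁I (≤-trans p≤ (⋁-mono (p⊆q∪⁅x⁆⇒p-x⊆q Y⊆)))
      ... | no  p∉Y = free Y (λ y∈Y → p⊆q∪⁅x⁆⇒p-x⊆q Y⊆ (x∈p∧x≢y⇒x∈p-y y∈Y λ { refl → p∉Y y∈Y }))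
                             Y≠∅

    complex : SimplicialComplex
    complex = record
      { k          = m
      ; H          = does ∘ independent?
      ; nonempty   = ∅ , dec-true (independent? ∅) independent-∅
      ; downClosed = λ I J J⊆I I-face →
          dec-true (independent? J) (independent-⊆ (dec-true⁻¹ (independent? I) I-face) J⊆I)
      }

    face⇒independent : ∀ {X} → SimplicialComplex.H complex X ≡ true → Independent X
    face⇒independent {X} = dec-true⁻¹ (independent? X)

    independent⇒face : ∀ {X} → Independent X → SimplicialComplex.H complex X ≡ true
    independent⇒face {X} = dec-true (independent? X)

    -- The vertices outside A are loops, hence belong to every flat and to every ↓ a.
    ↓_ : Fin (suc m) → Subset (suc m)
    ↓ a = subsetOf (λ v → (v ∈? A) →-dec (v ≤? a))

    ∈-↓⁺ : ∀ {a v} → (v ∈ A → v ≤ a) → v ∈ ↓ a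
    ∈-↓⁺ {a} = ∈-subsetOf⁺ (λ v → (v ∈? A) →-dec (v ≤? a))

    ∈-↓⁻ : ∀ {a v} → v ∈ ↓ a → v ∈ A → v ≤ a
    ∈-↓⁻ {a} = ∈-subsetOf⁻ (λ v → (v ∈? A) →-dec (v ≤? a))

    ↓-mono : ∀ {a b} → a ≤ b → ↓ a ⊆ ↓ b
    ↓-mono a≤b v∈↓a = ∈-↓⁺ (λ v∈A → ≤-trans (∈-↓⁻ v∈↓a v∈A) a≤b)

    ↓-flat : ∀ a → IsFlat complex (↓ a)
    ↓-flat a I I-face I⊆↓a p p∉↓a = independent⇒face (independent-extend I-ind p∈A p≰⋁I)
      where
      I-ind : Independent I
      I-ind = face⇒independent I-face
      p∈A : p ∈ A
      p∈A = decidable-stable (p ∈? A) (λ p∉A → p∉↓a (∈-↓⁺ (⊥-elim ∘ p∉A)))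
      p≰⋁I : ¬ (p ≤ ⋁ I)
      p≰⋁I p≤⋁I = p∉↓a (∈-↓⁺ λ _ →
        ≤-trans p≤⋁I (⋁-least λ i∈I → ∈-↓⁻ (I⊆↓a i∈I) (proj₁ I-ind i∈I)))

    ∉A⇒∈flat : ∀ {X v} → IsFlat complex X → v ∉ A → v ∈ X
    ∉A⇒∈flat {X} {v} X-flat v∉A = decidable-stable (v ∈? X) λ v∉X →
      v∉A (proj₁ (face⇒independent (X-flat ∅ (independent⇒face independent-∅) ⊥⊆ v v∉X))
                 (x∈p∪q⁺ (inj₂ (x∈⁅x⁆ v))))

    independent⇒transversal : ∀ {X} → Acc _⊂_ X → Independent X → FlatChainTransversal complex X (↓ (⋁ X))
    independent⇒transversal {X} (acc rec) X-ind with nonempty? X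
    ... | no  X≡∅ = trivialTransversal complex X≡∅ (↓-flat _)
    ... | yes X≠∅ with proj₂ X-ind X id X≠∅
    ...   | y , y∈X , y≰ = extendTransversal complex y∈X
              (independent⇒transversal (rec (x∈p⇒p-x⊂p y∈X)) (independent-⊆ X-ind (p─q⊆p X ⁅ y ⁆)))
              (↓-flat _) (↓-mono (⋁-mono (p─q⊆p X ⁅ y ⁆)))
              (∈-↓⁺ λ _ → ⋁-upper y∈X) (λ y∈ → y≰ (∈-↓⁻ y∈ (proj₁ X-ind y∈X)))

    complex-booleanRepresentable : BooleanRepresentable complex
    complex-booleanRepresentable X X-face = isFlatChainTransversal complex
      (independent⇒transversal (⊂-wellFounded X) (face⇒independent X-face))

    ↓-Iso : Set
    ↓-Iso = (∀ a b → (a ≤ b) ⇔ (↓ a ⊆ ↓ b)) × (∀ X → IsFlat complex X → ∃ λ a → ↓ a ≡ X)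

    ↓-iso? : Dec ↓-Iso
    ↓-iso? = all? (λ a → all? λ b → (a ≤? b) ⇔-dec (↓ a ⊆? ↓ b))
             ×-dec allSubset? (λ X → isFlat? complex X →-dec any? λ a → ≡-dec Bool._≟_ (↓ a) X)

    ↓-iso⇒BRFlat : ↓-Iso → IsBRFlatLattice L
    ↓-iso⇒BRFlat (order , onto) = complex , complex-booleanRepresentable , ↓_ , ↓-flat , order , onto

  module FromRepresentation
    (𝓗 : SimplicialComplex) (br : BooleanRepresentable 𝓗)
    (f : Fin (suc m) → Subset (suc (SimplicialComplex.k 𝓗)))
    (f-flat : ∀ a → IsFlat 𝓗 (f a))
    (f-order : ∀ a b → (a ≤ b) ⇔ (f a ⊆ f b))
    (f-onto : ∀ X → IsFlat 𝓗 X → ∃ λ a → f a ≡ X)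
    where
    open SimplicialComplex 𝓗

    f-reflects : ∀ {a b} → f a ⊆ f b → a ≤ b
    f-reflects = Equivalence.from (f-order _ _)

    f-∧ : ∀ {p a b} → p ∈ f a → p ∈ f b → p ∈ f (a ∧ b)
    f-∧ {p} {a} {b} p∈fa p∈fb with f-onto (f a ∩ f b) (∩-flat 𝓗 (f-flat a) (f-flat b))
    ... | c , fc≡fa∩fb = Equivalence.to (f-order c (a ∧ b))
                           (∧-greatest (f-reflects (proj₁ ∘ fc⊆)) (f-reflects (proj₂ ∘ fc⊆)))
                           (subst (p ∈_) (sym fc≡fa∩fb) (x∈p∩q⁺ (p∈fa , p∈fb)))
      where
      fc⊆ : ∀ {q} → q ∈ f c → q ∈ f a × q ∈ f b
      fc⊆ q∈fc = x∈p∩q⁻ (f a) (f b) (subst (_ ∈_) fc≡fa∩fb q∈fc)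

    top : Fin (suc m)
    top = proj₁ (f-onto ⊤ (⊤-flat 𝓗))

    ∈-f-top : ∀ p → p ∈ f top
    ∈-f-top p = subst (p ∈_) (sym (proj₂ (f-onto ⊤ (⊤-flat 𝓗)))) ∈⊤

    cl : V 𝓗 → Fin (suc m)
    cl p = foldr _∧_ top (filter (λ a → p ∈? f a) (allFin _))

    ∈-f-cl : ∀ p → p ∈ f (cl p)
    ∈-f-cl p = foldr-preservesᵇ {P = λ a → p ∈ f a} f-∧ (∈-f-top p) (all-filter (λ a → p ∈? f a) (allFin _))

    cl-least : ∀ {p a} → p ∈ f a → cl p ≤ a
    cl-least {p} {a} p∈fa = foldr-∧-≤ top (∈-filter⁺ (λ a → p ∈? f a) (∈-allFin a) p∈fa)

    cl-≤⇒∈ : ∀ {p a} → cl p ≤ a → p ∈ f a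
    cl-≤⇒∈ {p} {a} cl≤a = Equivalence.to (f-order (cl p) a) cl≤a (∈-f-cl p)

    cl⁻¹ : Subset (suc m) → Subset (suc k)
    cl⁻¹ X = subsetOf (λ p → cl p ∈? X)

    ∈-cl⁻¹⁺ : ∀ {X p} → cl p ∈ X → p ∈ cl⁻¹ X
    ∈-cl⁻¹⁺ {X} = ∈-subsetOf⁺ (λ p → cl p ∈? X)

    ∈-cl⁻¹⁻ : ∀ {X p} → p ∈ cl⁻¹ X → cl p ∈ X
    ∈-cl⁻¹⁻ {X} = ∈-subsetOf⁻ (λ p → cl p ∈? X)

    closures : Subset (suc m)
    closures = image cl ⊤

    cl∈closures : ∀ p → cl p ∈ closures
    cl∈closures p = ∈-image⁺ cl {a = p} ∈⊤

    open IndependentSets closures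

    ⋁-image-least : ∀ {W b} → W ⊆ f b → ⋁ (image cl W) ≤ b
    ⋁-image-least {W} {b} W⊆fb = ⋁-least bound
      where
      bound : ∀ {a} → a ∈ image cl W → a ≤ b
      bound a∈ with ∈-image⁻ cl a∈
      ... | p , p∈W , refl = cl-least (W⊆fb p∈W)

    face-has-free-closure : ∀ {I W} → H I ≡ true → W ⊆ I → Nonempty W →
                            ∃ λ q → q ∈ W × ¬ (cl q ≤ ⋁ (image cl (W - q)))
    face-has-free-closure I-face W⊆I W≠∅ with transversal-separates 𝓗 (br _ I-face) W⊆I W≠∅
    ... | q , q∈W , F , F-flat , W-q⊆F , q∉F with f-onto F F-flat
    ...   | b , refl = q , q∈W , λ cl≤ → q∉F (cl-≤⇒∈ (≤-trans cl≤ (⋁-image-least W-q⊆F)))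

    minus-cl⊆image-∩cl⁻¹ : ∀ {I Y q} → Y ⊆ image cl I → Y - cl q ⊆ image cl ((I ∩ cl⁻¹ Y) - q)
    minus-cl⊆image-∩cl⁻¹ {I} {Y} {q} Y⊆ {a} a∈ with ∈-image⁻ cl (Y⊆ (p─q⊆p Y _ a∈))
    ... | p , p∈I , refl = ∈-image⁺ cl (x∈p∧x≢y⇒x∈p-y p∈W (λ { refl → x∈p-y⇒x≢y a∈ refl }))
      where
      p∈W : p ∈ I ∩ cl⁻¹ Y
      p∈W = x∈p∩q⁺ (p∈I , ∈-cl⁻¹⁺ (p─q⊆p Y _ a∈))

    face⇒independent-image : ∀ {I} → H I ≡ true → Independent (image cl I)
    face⇒independent-image {I} I-face = image-mono cl (λ _ → ∈⊤) , free
      where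
      free : ∀ Y → Y ⊆ image cl I → Nonempty Y → ∃ λ y → y ∈ Y × ¬ (y ≤ ⋁ (Y - y))
      free Y Y⊆ (a , a∈Y) with ∈-image⁻ cl (Y⊆ a∈Y)
      ... | p , p∈I , refl
        with face-has-free-closure I-face (λ q∈ → proj₁ (x∈p∩q⁻ I _ q∈)) (p , x∈p∩q⁺ (p∈I , ∈-cl⁻¹⁺ a∈Y))
      ...   | q , q∈W , cl-q-free =
                cl q , ∈-cl⁻¹⁻ (proj₂ (x∈p∩q⁻ I _ q∈W)) ,
                λ cl-q≤ → cl-q-free (≤-trans cl-q≤ (⋁-mono (minus-cl⊆image-∩cl⁻¹ {q = q} Y⊆)))

    cl-injective : ∀ {I p q} → H I ≡ true → p ∈ I → q ∈ I → cl p ≡ cl q → p ≡ q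
    cl-injective {I} {p} {q} I-face p∈I q∈I clp≡clq =
      decidable-stable (p ≟ q) λ p≢q → no-free-element p≢q (face-has-free-closure I-face W⊆I (p , p∈W))
      where
      W : Subset (suc k)
      W = ⁅ p ⁆ ∪ ⁅ q ⁆
      p∈W : p ∈ W
      p∈W = x∈p∪q⁺ (inj₁ (x∈⁅x⁆ p))
      q∈W : q ∈ W
      q∈W = x∈p∪q⁺ (inj₂ (x∈⁅x⁆ q))
      W⊆I : W ⊆ I
      W⊆I w∈W with x∈p∪q⁻ ⁅ p ⁆ ⁅ q ⁆ w∈W
      ... | inj₁ w∈⁅p⁆ = subst (_∈ I) (sym (x∈⁅y⁆⇒x≡y p w∈⁅p⁆)) p∈I
      ... | inj₂ w∈⁅q⁆ = subst (_∈ I) (sym (x∈⁅y⁆⇒x≡y q w∈⁅q⁆)) q∈I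
      shared : ∀ {u v} → u ∈ W → u ≢ v → cl u ≡ cl v → cl v ≤ ⋁ (image cl (W - v))
      shared u∈W u≢v clu≡clv = subst (_≤ _) clu≡clv (⋁-upper (∈-image⁺ cl (x∈p∧x≢y⇒x∈p-y u∈W u≢v)))
      no-free-element : p ≢ q → ¬ (∃ λ w → w ∈ W × ¬ (cl w ≤ ⋁ (image cl (W - w))))
      no-free-element p≢q (w , w∈W , free) with x∈p∪q⁻ ⁅ p ⁆ ⁅ q ⁆ w∈W
      ... | inj₁ w∈⁅p⁆ with refl ← x∈⁅y⁆⇒x≡y p w∈⁅p⁆ = free (shared q∈W (p≢q ∘ sym) (sym clp≡clq))
      ... | inj₂ w∈⁅q⁆ with refl ← x∈⁅y⁆⇒x≡y q w∈⁅q⁆ = free (shared p∈W p≢q clp≡clq)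

    cl-InjectiveOn : Subset (suc k) → Set
    cl-InjectiveOn Z = ∀ {p q} → p ∈ Z → q ∈ Z → cl p ≡ cl q → p ≡ q

    independent-image⇒face : ∀ {Z} → Acc _⊂_ Z → cl-InjectiveOn Z → Independent (image cl Z) → H Z ≡ true
    independent-image⇒face {Z} (acc rec) cl-inj Z-ind with nonempty? Z
    ... | no  Z≡∅ = empty-face 𝓗 Z≡∅
    ... | yes (z , z∈Z) with proj₂ Z-ind (image cl Z) id (cl z , ∈-image⁺ cl z∈Z)
    ...   | a , a∈ , a≰ with ∈-image⁻ cl a∈
    ...     | q , q∈Z , refl = downClosed _ Z p⊆p-x∪⁅x⁆ (f-flat _ (Z - q) Z-q-face Z-q⊆ q q∉)
      where
      Z-q-face : H (Z - q) ≡ true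
      Z-q-face = independent-image⇒face (rec (x∈p⇒p-x⊂p q∈Z))
        (λ p∈ p′∈ → cl-inj (p─q⊆p Z _ p∈) (p─q⊆p Z _ p′∈))
        (independent-⊆ Z-ind (image-mono cl (p─q⊆p Z ⁅ q ⁆)))
      Z-q⊆ : Z - q ⊆ f (⋁ (image cl (Z - q)))
      Z-q⊆ p∈ = cl-≤⇒∈ (⋁-upper (∈-image⁺ cl p∈))
      image-Z-q⊆ : image cl (Z - q) ⊆ image cl Z - cl q
      image-Z-q⊆ a∈ with ∈-image⁻ cl a∈
      ... | p , p∈Z-q , refl = x∈p∧x≢y⇒x∈p-y (image-mono cl (p─q⊆p Z _) a∈)
                                 (λ clp≡clq → x∈p-y⇒x≢y p∈Z-q (cl-inj (p─q⊆p Z _ p∈Z-q) q∈Z clp≡clq))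
      q∉ : q ∉ f (⋁ (image cl (Z - q)))
      q∉ q∈ = a≰ (≤-trans (cl-least q∈) (⋁-mono image-Z-q⊆))

    cl⁻¹-flat : ∀ {X} → IsFlat complex X → IsFlat 𝓗 (cl⁻¹ X)
    cl⁻¹-flat {X} X-flat I I-face I⊆ p p∉ =
      independent-image⇒face (⊂-wellFounded _) cl-inj (independent-⊆ I∪p-ind image⊆)
      where
      cl-I⊆X : ∀ {p′} → p′ ∈ I → cl p′ ∈ X
      cl-I⊆X p′∈I = ∈-cl⁻¹⁻ (I⊆ p′∈I)
      clp∉X : cl p ∉ X
      clp∉X = p∉ ∘ ∈-cl⁻¹⁺
      image-I⊆X : image cl I ⊆ X
      image-I⊆X a∈ with ∈-image⁻ cl a∈
      ... | _ , p′∈I , refl = cl-I⊆X p′∈I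
      I∪p-ind : Independent (image cl I ∪ ⁅ cl p ⁆)
      I∪p-ind = face⇒independent
        (X-flat _ (independent⇒face (face⇒independent-image I-face)) image-I⊆X (cl p) clp∉X)
      image⊆ : image cl (I ∪ ⁅ p ⁆) ⊆ image cl I ∪ ⁅ cl p ⁆
      image⊆ a∈ with ∈-image⁻ cl a∈
      ... | p′ , p′∈ , refl with x∈p∪q⁻ I ⁅ p ⁆ p′∈
      ...   | inj₁ p′∈I = x∈p∪q⁺ (inj₁ (∈-image⁺ cl p′∈I))
      ...   | inj₂ p′∈⁅p⁆ with refl ← x∈⁅y⁆⇒x≡y p p′∈⁅p⁆ = x∈p∪q⁺ (inj₂ (x∈⁅x⁆ (cl p)))
      cl-inj : cl-InjectiveOn (I ∪ ⁅ p ⁆)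
      cl-inj p₁∈ p₂∈ eq with x∈p∪q⁻ I ⁅ p ⁆ p₁∈ | x∈p∪q⁻ I ⁅ p ⁆ p₂∈
      ... | inj₁ p₁∈I | inj₁ p₂∈I = cl-injective I-face p₁∈I p₂∈I eq
      ... | inj₁ p₁∈I | inj₂ p₂∈⁅p⁆ with refl ← x∈⁅y⁆⇒x≡y p p₂∈⁅p⁆ =
        ⊥-elim (clp∉X (subst (_∈ X) eq (cl-I⊆X p₁∈I)))
      ... | inj₂ p₁∈⁅p⁆ | inj₁ p₂∈I with refl ← x∈⁅y⁆⇒x≡y p p₁∈⁅p⁆ =
        ⊥-elim (clp∉X (subst (_∈ X) (sym eq) (cl-I⊆X p₂∈I)))
      ... | inj₂ p₁∈⁅p⁆ | inj₂ p₂∈⁅p⁆ = trans (x∈⁅y⁆⇒x≡y p p₁∈⁅p⁆) (sym (x∈⁅y⁆⇒x≡y p p₂∈⁅p⁆))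

    ↓-order : ∀ a b → (a ≤ b) ⇔ (↓ a ⊆ ↓ b)
    ↓-order a b = mk⇔ ↓-mono λ ↓a⊆↓b → f-reflects λ {p} p∈fa →
      cl-≤⇒∈ {p} (∈-↓⁻ (↓a⊆↓b (∈-↓⁺ λ _ → cl-least p∈fa)) (cl∈closures p))

    ↓-onto : ∀ X → IsFlat complex X → ∃ λ a → ↓ a ≡ X
    ↓-onto X X-flat with f-onto (cl⁻¹ X) (cl⁻¹-flat X-flat)
    ... | a , fa≡cl⁻¹X = a , ⊆-antisym ↓a⊆X X⊆↓a
      where
      ↓a⊆X : ↓ a ⊆ X
      ↓a⊆X {v} v∈↓a with v ∈? closures
      ... | no  v∉A = ∉A⇒∈flat X-flat v∉A
      ... | yes v∈A with ∈-image⁻ cl v∈A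
      ...   | p , _ , refl = ∈-cl⁻¹⁻ (subst (p ∈_) fa≡cl⁻¹X (cl-≤⇒∈ (∈-↓⁻ v∈↓a v∈A)))
      X⊆↓a : X ⊆ ↓ a
      X⊆↓a {v} v∈X = ∈-↓⁺ bound
        where
        bound : v ∈ closures → v ≤ a
        bound v∈A with ∈-image⁻ cl v∈A
        ... | p , _ , refl = cl-least (subst (p ∈_) (sym fa≡cl⁻¹X) (∈-cl⁻¹⁺ v∈X))

    ↓-iso : ↓-Iso
    ↓-iso = ↓-order , ↓-onto

  isBRFlatLattice? : Dec (IsBRFlatLattice L)
  isBRFlatLattice? =
    map′ (λ (A , iso) → IndependentSets.↓-iso⇒BRFlat A iso)
         (λ (𝓗 , br , f , f-flat , f-order , f-onto) →
            _ , FromRepresentation.↓-iso 𝓗 br f f-flat f-order f-onto)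
         (anySubset? IndependentSets.↓-iso?)

corollary5p3 : (L : FinLattice) → Dec (IsBRFlatLattice L)
corollary5p3 record { size = zero } = no λ (𝓗 , _ , _ , _ , _ , f-onto) → ¬Fin0 (proj₁ (f-onto ⊤ (⊤-flat 𝓗)))
corollary5p3 record { size = suc m ; _≤?_ = _≤?_ ; isLattice = isLattice } =
  FlatLatticeCriterion.isBRFlatLattice? _≤?_ isLattice
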